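{- Let $n,k,j$ be integers with $1\le k\le n$ and $j\ge 0$. Then $$[u^0v^j]\,S(n,k;u,v)=[v^j]\,S(n,k;0,v)=\left|\{\pi\in\mathrm{SLP}_{n,k}:\mathrm{nse}(\pi)=j\}\right|=\left[ {n\atop n-j}\right]\left\{ {n-j\atop k}\right\}.$$
   Context: $[n]=\{1,\dots,n\}$. $\mathrm{LLP}_{n,k}$ is the set of partitions of $[n]$ into $k$ nonempty blocks where the blocks are linearly ordered $(B_1,\dots,B_k)$ and each block is a linear list of its elements. $\mathrm{SLP}_{n,k}$ is the set of partitions of $[n]$ into $k$ nonempty blocks, each block being a linear list, with the blocks unordered. For such $\pi$: the label of a block is its smallest element; $\mathrm{nsb}(\pi)$ (nonstandard blocks) is the number of blocks that must be moved to the right in order to arrange the blocks in increasing order of labels, i.e. the number of positions $r$ such that the label of $B_r$ exceeds the label of some $B_s$ with $s>r$; $\mathrm{nse}(\pi)$ (nonstandard elements) is the total, over all blocks, of the number of elements that must be moved to the right within their block to make the block increasing, i.e. the number of entries of a list having some smaller entry to their right in the same list. Define $S(n,k;u,v)=\sum_{\pi\in\mathrm{LLP}_{n,k}}u^{\mathrm{nsb}(\pi)}v^{\mathrm{nse}(\pi)}$. $\left[ {n\atop m}\right]$ denotes the unsigned Stirling number of the first kind and $\left\{ {n\atop m}\right\}$ the Stirling number of the second kind. -}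

module Defs where

open import Data.Nat using (ℕ; zero; suc; _+_; _*_; _⊓_; _<ᵇ_; _≤ᵇ_; _≡ᵇ_)
open import Data.Bool using (Bool; true; false; _∧_; not; if_then_else_; T)
open import Data.List using (List; []; _∷_; length; map; concat; foldr)
open import Data.Bool.ListAction using (any; all)
open import Data.Nat.ListAction using (sum)
open import Data.Product using (Σ)
open import Data.Fin using (Fin)
open import Function.Bundles using (_⤖_)

Blocks : Set
Blocks = List (List ℕ)

-- Label of a block: its smallest element (only used on nonempty blocks).
label : List ℕ → ℕ
label []       = 0
label (x ∷ xs) = foldr _⊓_ x xs

nseBlock : List ℕ → ℕ
nseBlock []       = 0
nseBlock (x ∷ xs) = (if any (λ y → y <ᵇ x) xs then 1 else 0) + nseBlock xs

nse : Blocks → ℕ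
nse bs = sum (map nseBlock bs)

nsb : Blocks → ℕ
nsb []       = 0
nsb (b ∷ bs) = (if any (λ c → label c <ᵇ label b) bs then 1 else 0) + nsb bs

noDup : List ℕ → Bool
noDup []       = true
noDup (x ∷ xs) = not (any (λ y → y ≡ᵇ x) xs) ∧ noDup xs

nonempty : List ℕ → Bool
nonempty []      = false
nonempty (_ ∷ _) = true

isPermOfRange : ℕ → List ℕ → Bool
isPermOfRange n xs =
  (length xs ≡ᵇ n) ∧ all (λ x → (1 ≤ᵇ x) ∧ (x ≤ᵇ n)) xs ∧ noDup xs

-- bs ∈ LLP_{n,k}: k nonempty blocks (linearly ordered, each a linear list)
-- whose entries together are exactly [n], each once.
isLLP : ℕ → ℕ → Blocks → Bool
isLLP n k bs = (length bs ≡ᵇ k) ∧ all nonempty bs ∧ isPermOfRange n (concat bs)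

labelsIncreasing : Blocks → Bool
labelsIncreasing []           = true
labelsIncreasing (b ∷ [])     = true
labelsIncreasing (b ∷ c ∷ bs) = (label b <ᵇ label c) ∧ labelsIncreasing (c ∷ bs)

-- SLP_{n,k}: the blocks are unordered; an unordered set of blocks is represented
-- by its canonical listing, blocks in increasing order of labels.
isSLP : ℕ → ℕ → Blocks → Bool
isSLP n k bs = isLLP n k bs ∧ labelsIncreasing bs

LLP : ℕ → ℕ → Set
LLP n k = Σ Blocks (λ bs → T (isLLP n k bs))

SLP : ℕ → ℕ → Set
SLP n k = Σ Blocks (λ bs → T (isSLP n k bs))

-- Elements of LLP_{n,k} with nsb = a and nse = b; its cardinality is the
-- coefficient [u^a v^b] S(n,k;u,v).
LLPwith : ℕ → ℕ → ℕ → ℕ → Set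
LLPwith n k a b = Σ Blocks (λ bs → T (isLLP n k bs ∧ (nsb bs ≡ᵇ a) ∧ (nse bs ≡ᵇ b)))

SLPwith : ℕ → ℕ → ℕ → Set
SLPwith n k j = Σ Blocks (λ bs → T (isSLP n k bs ∧ (nse bs ≡ᵇ j)))

HasCard : Set → ℕ → Set
HasCard A m = A ⤖ Fin m

stirling1 : ℕ → ℕ → ℕ
stirling1 zero    zero    = 1
stirling1 zero    (suc _) = 0
stirling1 (suc n) zero    = 0
stirling1 (suc n) (suc m) = n * stirling1 n (suc m) + stirling1 n m

stirling2 : ℕ → ℕ → ℕ
stirling2 zero    zero    = 1
stirling2 zero    (suc _) = 0
stirling2 (suc n) zero    = 0
stirling2 (suc n) (suc m) = suc m * stirling2 n (suc m) + stirling2 n m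

module Submission where

-- Part 1. A listing of linear lists has nsb = 0 exactly when its block labels
-- strictly increase (distinct blocks have distinct smallest elements), so
-- LLP(n, k) restricted to nsb = 0 is literally the set of canonical listings
-- of SLP(n, k), and it suffices to count SLP(n, k) by nse.
--
-- Part 2. Remove the largest element N = n + 1 from a canonical listing of
-- SLP(n + 1, k + 1) with nse = j.  Either N formed a singleton block (which,
-- having the largest label, is the last one), or N ended one of the k + 1
-- blocks (nse unchanged), or N stood right before one of the n other entries
-- (nse drops by one).  This bijection gives the recurrence
--   C(n+1, k+1, j) = C(n, k, j) + (k + 1) C(n, k+1, j) + n C(n, k+1, j - 1),
-- which for n ≥ 1 is also satisfied by [n, n - j] {n - j, k}, by the
-- recurrences of the two kinds of Stirling numbers.

open import Defs
open import Data.Nat using (ℕ; zero; suc; _+_; _*_; _∸_; _⊓_; _<ᵇ_; _≤ᵇ_; _≡ᵇ_; _≤_; _<_; z≤n; s≤s; s≤s⁻¹; _≟_; _<?_)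
open import Data.Nat.Properties
open import Algebra.Properties.CommutativeSemigroup +-commutativeSemigroup using () renaming (x∙yz≈y∙xz to +-exchange)
open import Data.Nat.ListAction using (sum)
open import Data.Nat.Tactic.RingSolver using (solve-∀)
open import Data.Bool using (Bool; true; false; _∧_; _∨_; not; T)
open import Data.Bool.Properties using (T-∧; T-≡; T-not-≡; T-irrelevant)
open import Data.Bool.ListAction using (any; all)
open import Data.List using (List; []; _∷_; length; map; concat; foldr; _++_)
open import Data.List.Properties using (∷-injective; length-++)
open import Data.List.Membership.Propositional using (_∈_)
open import Data.List.Relation.Unary.All using (All; []; _∷_; lookup) renaming (map to All-map)
import Data.List.Relation.Unary.All.Properties as All
open import Data.List.Relation.Unary.Any using (here; there)
import Data.List.Relation.Unary.Any.Properties as Any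
open import Data.List.Relation.Unary.Unique.Propositional using (Unique; []; _∷_)
open import Data.Fin using (Fin; zero; toℕ; fromℕ<)
open import Data.Fin.Properties using (+↔⊎; *↔×; toℕ<n; toℕ-fromℕ<; fromℕ<-toℕ)
open import Data.Product using (Σ; _×_; _,_; proj₁; proj₂)
open import Data.Product.Function.NonDependent.Propositional using (_×-↔_)
open import Data.Sum using (_⊎_; inj₁; inj₂)
open import Data.Sum.Function.Propositional using (_⊎-↔_)
open import Data.Empty using (⊥; ⊥-elim)
open import Function using (_∘_)
open import Function.Bundles using (Equivalence; _↔_; mk↔ₛ′)
open import Function.Properties.Inverse using (↔-refl; ↔-sym; ↔-trans; ↔⇒⤖)
open import Relation.Nullary using (¬_; yes; no)
open import Relation.Binary.PropositionalEquality

∧-elim : ∀ {a b} → T (a ∧ b) → T a × T b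
∧-elim = Equivalence.to T-∧

∧-intro : ∀ {a b} → T a → T b → T (a ∧ b)
∧-intro p q = Equivalence.from T-∧ (p , q)

¬T⇒≡false : ∀ {b} → ¬ T b → b ≡ false
¬T⇒≡false {true}  ¬t = ⊥-elim (¬t _)
¬T⇒≡false {false} _  = refl

≡false⇒¬T : ∀ {b} → b ≡ false → ¬ T b
≡false⇒¬T refl ()

any≡false⇒All : ∀ {A : Set} (p : A → Bool) xs → any p xs ≡ false → All (λ x → p x ≡ false) xs
any≡false⇒All p []       _ = []
any≡false⇒All p (x ∷ xs) e with p x in px | e
... | false | e′ = px ∷ any≡false⇒All p xs e′

All⇒any≡false : ∀ {A : Set} (p : A → Bool) {xs} → All (λ x → p x ≡ false) xs → any p xs ≡ false
All⇒any≡false p []       = refl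
All⇒any≡false p (e ∷ es) rewrite e = All⇒any≡false p es

noDup⇒Unique : ∀ xs → T (noDup xs) → Unique xs
noDup⇒Unique []       _ = []
noDup⇒Unique (x ∷ xs) t with ∧-elim t
... | fresh , rest =
  All-map (λ e x≡y → ≡false⇒¬T e (≡⇒≡ᵇ _ x (sym x≡y)))
          (any≡false⇒All _ xs (Equivalence.to T-not-≡ fresh))
  ∷ noDup⇒Unique xs rest

Unique⇒noDup : ∀ {xs} → Unique xs → T (noDup xs)
Unique⇒noDup {[]}     []           = _
Unique⇒noDup {x ∷ xs} (fresh ∷ us) =
  ∧-intro (Equivalence.from T-not-≡
            (All⇒any≡false _ (All-map (λ x≢y → ¬T⇒≡false (x≢y ∘ sym ∘ ≡ᵇ⇒≡ _ x)) fresh)))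
          (Unique⇒noDup us)

InRange : ℕ → ℕ → Set
InRange n x = 1 ≤ x × x ≤ n

record IsPermOfRange (n : ℕ) (xs : List ℕ) : Set where
  constructor mkPerm
  field
    length≡  : length xs ≡ n
    inRange  : All (InRange n) xs
    distinct : Unique xs
open IsPermOfRange public

isPermOfRange⇒IsPermOfRange : ∀ n xs → T (isPermOfRange n xs) → IsPermOfRange n xs
isPermOfRange⇒IsPermOfRange n xs t with ∧-elim t
... | len , rest with ∧-elim rest
... | rng , nd =
  mkPerm (≡ᵇ⇒≡ _ n len)
         (All-map (λ b → let (p , q) = ∧-elim b in ≤ᵇ⇒≤ 1 _ p , ≤ᵇ⇒≤ _ n q) (All.all⁺ _ xs rng))
         (noDup⇒Unique xs nd)

IsPermOfRange⇒isPermOfRange : ∀ {n xs} → IsPermOfRange n xs → T (isPermOfRange n xs)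
IsPermOfRange⇒isPermOfRange {n} (mkPerm len rng nd) =
  ∧-intro (≡⇒≡ᵇ _ n len)
    (∧-intro (All.all⁻ _ (All-map (λ (p , q) → ∧-intro (≤⇒≤ᵇ p) (≤⇒≤ᵇ q)) rng))
             (Unique⇒noDup nd))

NonEmpty : List ℕ → Set
NonEmpty b = T (nonempty b)

record IsSLP (n k j : ℕ) (bs : Blocks) : Set where
  constructor mkSLP
  field
    blockCount     : length bs ≡ k
    blocksNonEmpty : All NonEmpty bs
    perm           : IsPermOfRange n (concat bs)
    increasing     : T (labelsIncreasing bs)
    nse≡           : nse bs ≡ j
open IsSLP public

SLPwith⇒IsSLP : ∀ {n k j} bs → T (isSLP n k bs ∧ (nse bs ≡ᵇ j)) → IsSLP n k j bs
SLPwith⇒IsSLP {n} {k} {j} bs t with ∧-elim t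
... | slp , nse-ok with ∧-elim slp
... | llp , incr with ∧-elim llp
... | len , rest with ∧-elim rest
... | ne , prm =
  mkSLP (≡ᵇ⇒≡ _ k len) (All.all⁺ _ bs ne) (isPermOfRange⇒IsPermOfRange n _ prm) incr (≡ᵇ⇒≡ _ j nse-ok)

IsSLP⇒SLPwith : ∀ {n k j bs} → IsSLP n k j bs → T (isSLP n k bs ∧ (nse bs ≡ᵇ j))
IsSLP⇒SLPwith {n} {k} {j} (mkSLP len ne prm incr nse-ok) =
  ∧-intro (∧-intro (∧-intro (≡⇒≡ᵇ _ k len)
                             (∧-intro (All.all⁻ _ ne) (IsPermOfRange⇒isPermOfRange prm)))
                    incr)
          (≡⇒≡ᵇ _ j nse-ok)

Σ-T-≡ : ∀ {f : Blocks → Bool} {x y : Σ Blocks (T ∘ f)} → proj₁ x ≡ proj₁ y → x ≡ y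
Σ-T-≡ {x = bs , p} {y = .bs , q} refl = cong (bs ,_) (T-irrelevant p q)

data Ins {A : Set} (x : A) : List A → List A → Set where
  here  : ∀ {xs} → Ins x xs (x ∷ xs)
  there : ∀ {y xs ys} → Ins x xs ys → Ins x (y ∷ xs) (y ∷ ys)

module _ {A : Set} {x : A} where

  ins-length : ∀ {xs ys} → Ins x xs ys → length ys ≡ suc (length xs)
  ins-length here      = refl
  ins-length (there i) = cong suc (ins-length i)

  ins-++ˡ : ∀ {xs ys} zs → Ins x xs ys → Ins x (zs ++ xs) (zs ++ ys)
  ins-++ˡ []       i = i
  ins-++ˡ (z ∷ zs) i = there (ins-++ˡ zs i)

  ins-++ʳ : ∀ {xs ys} zs → Ins x xs ys → Ins x (xs ++ zs) (ys ++ zs)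
  ins-++ʳ zs here      = here
  ins-++ʳ zs (there i) = there (ins-++ʳ zs i)

  ins-snoc : ∀ xs → Ins x xs (xs ++ x ∷ [])
  ins-snoc []       = here
  ins-snoc (y ∷ xs) = there (ins-snoc xs)

  All-ins⁻ : ∀ {P : A → Set} {xs ys} → Ins x xs ys → All P ys → P x × All P xs
  All-ins⁻ here      (px ∷ pxs) = px , pxs
  All-ins⁻ (there i) (py ∷ pys) = proj₁ (All-ins⁻ i pys) , py ∷ proj₂ (All-ins⁻ i pys)

  All-ins⁺ : ∀ {P : A → Set} {xs ys} → Ins x xs ys → P x → All P xs → All P ys
  All-ins⁺ here      px pxs        = px ∷ pxs
  All-ins⁺ (there i) px (py ∷ pys) = py ∷ All-ins⁺ i px pys

  Unique-ins⁺ : ∀ {xs ys} → Ins x xs ys → All (_≢ x) xs → Unique xs → Unique ys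
  Unique-ins⁺ here      fresh         u          = All-map (λ y≢x → y≢x ∘ sym) fresh ∷ u
  Unique-ins⁺ (there i) (y≢x ∷ fresh) (yu ∷ u) = All-ins⁺ i y≢x yu ∷ Unique-ins⁺ i fresh u

  Unique-ins⁻ : ∀ {xs ys} → Ins x xs ys → Unique ys → All (_≢ x) xs × Unique xs
  Unique-ins⁻ here      (xu ∷ u) = All-map (λ x≢y y≡x → x≢y (sym y≡x)) xu , u
  Unique-ins⁻ (there i) (yu ∷ u) with All-ins⁻ i yu | Unique-ins⁻ i u
  ... | y≢x , yu′ | fresh , u′ = y≢x ∷ fresh , yu′ ∷ u′

extract : ∀ x xs → Σ (List ℕ) (λ xs′ → Ins x xs′ xs) ⊎ All (_≢ x) xs
extract x []       = inj₂ []
extract x (y ∷ ys) with y ≟ x | extract x ys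
... | yes refl | _               = inj₁ (ys , here)
... | no y≢x   | inj₁ (ys′ , i) = inj₁ (y ∷ ys′ , there i)
... | no y≢x   | inj₂ fresh      = inj₂ (y≢x ∷ fresh)

InRange-lower : ∀ {n xs} → All (InRange (suc n)) xs → All (_≢ suc n) xs → All (InRange n) xs
InRange-lower []              []           = []
InRange-lower ((p , q) ∷ rng) (ne ∷ fresh) = (p , s≤s⁻¹ (≤∧≢⇒< q ne)) ∷ InRange-lower rng fresh

pigeonhole : ∀ m xs → Unique xs → All (InRange m) xs → length xs ≤ m
pigeonhole zero    []       _ _                 = z≤n
pigeonhole zero    (x ∷ xs) _ ((p , q) ∷ _)     = ⊥-elim (1+n≰n (≤-trans p q))
pigeonhole (suc m) xs       u rng with extract (suc m) xs
... | inj₁ (xs′ , i) =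
  let fresh , u′ = Unique-ins⁻ i u in
  subst (_≤ suc m) (sym (ins-length i))
        (s≤s (pigeonhole m xs′ u′ (InRange-lower (proj₂ (All-ins⁻ i rng)) fresh)))
... | inj₂ fresh = m≤n⇒m≤1+n (pigeonhole m xs u (InRange-lower rng fresh))

perm-ins⁺ : ∀ {n xs ys} → IsPermOfRange n xs → Ins (suc n) xs ys → IsPermOfRange (suc n) ys
perm-ins⁺ (mkPerm len rng u) i =
  mkPerm (trans (ins-length i) (cong suc len))
         (All-ins⁺ i (s≤s z≤n , ≤-refl) (All-map (λ (p , q) → p , m≤n⇒m≤1+n q) rng))
         (Unique-ins⁺ i (All-map (λ (_ , q) e → 1+n≰n (subst (_≤ _) e q)) rng) u)

perm-ins⁻ : ∀ {n xs ys} → IsPermOfRange (suc n) ys → Ins (suc n) xs ys → IsPermOfRange n xs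
perm-ins⁻ (mkPerm len rng u) i =
  let fresh , u′ = Unique-ins⁻ i u in
  mkPerm (suc-injective (trans (sym (ins-length i)) len))
         (InRange-lower (proj₂ (All-ins⁻ i rng)) fresh) u′

ins-NonEmpty : ∀ {x xs ys} → Ins x xs ys → NonEmpty ys
ins-NonEmpty here      = _
ins-NonEmpty (there _) = _

foldr-⊓-seed : ∀ a b ys → foldr _⊓_ (a ⊓ b) ys ≡ a ⊓ foldr _⊓_ b ys
foldr-⊓-seed a b []       = refl
foldr-⊓-seed a b (z ∷ zs) = begin
  z ⊓ foldr _⊓_ (a ⊓ b) zs ≡⟨ cong (z ⊓_) (foldr-⊓-seed a b zs) ⟩
  z ⊓ (a ⊓ foldr _⊓_ b zs) ≡⟨ sym (⊓-assoc z a _) ⟩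
  z ⊓ a ⊓ foldr _⊓_ b zs   ≡⟨ cong (_⊓ foldr _⊓_ b zs) (⊓-comm z a) ⟩
  a ⊓ z ⊓ foldr _⊓_ b zs   ≡⟨ ⊓-assoc a z _ ⟩
  a ⊓ (z ⊓ foldr _⊓_ b zs) ∎
  where open ≡-Reasoning

label-cons : ∀ x ys → NonEmpty ys → label (x ∷ ys) ≡ x ⊓ label ys
label-cons x (y ∷ ys) _ = begin
  y ⊓ foldr _⊓_ x ys   ≡⟨ sym (foldr-⊓-seed y x ys) ⟩
  foldr _⊓_ (y ⊓ x) ys ≡⟨ cong (λ s → foldr _⊓_ s ys) (⊓-comm y x) ⟩
  foldr _⊓_ (x ⊓ y) ys ≡⟨ foldr-⊓-seed x y ys ⟩
  x ⊓ foldr _⊓_ y ys   ∎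
  where open ≡-Reasoning

label-∈ : ∀ b → NonEmpty b → label b ∈ b
label-∈ (x ∷ [])     _ = here refl
label-∈ (x ∷ y ∷ ys) _ =
  subst (_∈ x ∷ y ∷ ys) (sym (label-cons x (y ∷ ys) _)) (⊓-∈ (label-∈ (y ∷ ys) _))
  where
  ⊓-∈ : ∀ {l} → l ∈ y ∷ ys → x ⊓ l ∈ x ∷ y ∷ ys
  ⊓-∈ {l} l∈ys with ⊓-sel x l
  ... | inj₁ x⊓l≡x = here x⊓l≡x
  ... | inj₂ x⊓l≡l = there (subst (_∈ y ∷ ys) (sym x⊓l≡l) l∈ys)

label-≤ : ∀ {m} b → All (_≤ m) b → label b ≤ m
label-≤ []       _       = z≤n
label-≤ (x ∷ xs) (p ∷ _) = ≤-trans (fold≤seed x xs) p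
  where
  fold≤seed : ∀ a ys → foldr _⊓_ a ys ≤ a
  fold≤seed a []       = ≤-refl
  fold≤seed a (y ∷ ys) = ≤-trans (m⊓n≤n y _) (fold≤seed a ys)

label-ins : ∀ {m ys zs} → Ins m ys zs → NonEmpty ys → All (_≤ m) ys → label zs ≡ label ys
label-ins {m} {y ∷ ys} here ne ys≤m =
  trans (label-cons m (y ∷ ys) ne) (m≥n⇒m⊓n≡n (label-≤ (y ∷ ys) ys≤m))
label-ins {m} (there {y} {[]} here) _ (y≤m ∷ _) = m≥n⇒m⊓n≡n y≤m
label-ins {m} (there {y} {w ∷ ws} {zs} i) _ (_ ∷ ws≤m) = begin
  label (y ∷ zs)     ≡⟨ label-cons y zs (ins-NonEmpty i) ⟩
  y ⊓ label zs       ≡⟨ cong (y ⊓_) (label-ins i _ ws≤m) ⟩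
  y ⊓ label (w ∷ ws) ≡⟨ sym (label-cons y (w ∷ ws) _) ⟩
  label (y ∷ w ∷ ws) ∎
  where open ≡-Reasoning

insAt : ℕ → ℕ → List ℕ → List ℕ
insAt m zero    ys       = m ∷ ys
insAt m (suc p) []       = m ∷ []
insAt m (suc p) (y ∷ ys) = y ∷ insAt m p ys

insAt-ins : ∀ m p ys → Ins m ys (insAt m p ys)
insAt-ins m zero    ys       = here
insAt-ins m (suc p) []       = here
insAt-ins m (suc p) (y ∷ ys) = there (insAt-ins m p ys)

any-ins : ∀ {z l l′} (p : ℕ → Bool) → Ins z l l′ → p z ≡ false → any p l′ ≡ any p l
any-ins p here      pz≡false rewrite pz≡false = refl
any-ins p (there {y} i) pz≡false = cong (p y ∨_) (any-ins p i pz≡false)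

-- An entry larger than everything else is nonstandard iff something follows it:
-- appended at the end it costs nothing …
nseBlock-snoc : ∀ m ys → All (_≤ m) ys → nseBlock (ys ++ m ∷ []) ≡ nseBlock ys
nseBlock-snoc m []       _            = refl
nseBlock-snoc m (y ∷ ys) (y≤m ∷ ys≤m)
  rewrite any-ins (_<ᵇ y) (ins-snoc ys) (¬T⇒≡false (≤⇒≯ y≤m ∘ <ᵇ⇒< m y))
        | nseBlock-snoc m ys ys≤m = refl

-- … while inserted before an existing entry it adds exactly one.
nseBlock-insAt : ∀ m p ys → p < length ys → All (_< m) ys → nseBlock (insAt m p ys) ≡ suc (nseBlock ys)
nseBlock-insAt m zero    (y ∷ ys) _ (y<m ∷ _) rewrite Equivalence.to T-≡ (<⇒<ᵇ y<m) = refl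
nseBlock-insAt m (suc p) (y ∷ ys) p<len (y<m ∷ ys<m)
  rewrite any-ins (_<ᵇ y) (insAt-ins m p ys) (¬T⇒≡false (≤⇒≯ (<⇒≤ y<m) ∘ <ᵇ⇒< m y))
        | nseBlock-insAt m p ys (s≤s⁻¹ p<len) ys<m = +-suc _ (nseBlock ys)

sum-map-ins : ∀ {A : Set} (f : A → ℕ) {x xs ys} → Ins x xs ys → sum (map f ys) ≡ f x + sum (map f xs)
sum-map-ins f here              = refl
sum-map-ins f (there {y} {xs} i) =
  trans (cong (f y +_) (sum-map-ins f i)) (+-exchange (f y) _ (sum (map f xs)))

labelsIncreasing-cong : ∀ bs cs → map label bs ≡ map label cs → labelsIncreasing bs ≡ labelsIncreasing cs
labelsIncreasing-cong []            []            _ = refl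
labelsIncreasing-cong (_ ∷ [])      (_ ∷ [])      _ = refl
labelsIncreasing-cong (b ∷ b′ ∷ bs) (c ∷ c′ ∷ cs) e =
  cong₂ _∧_ (cong₂ _<ᵇ_ (proj₁ heads) (proj₁ (∷-injective (proj₂ heads))))
            (labelsIncreasing-cong (b′ ∷ bs) (c′ ∷ cs) (proj₂ heads))
  where heads = ∷-injective e
labelsIncreasing-cong []            (_ ∷ _)       ()
labelsIncreasing-cong (_ ∷ _)       []            ()
labelsIncreasing-cong (_ ∷ [])      (_ ∷ _ ∷ _)   ()
labelsIncreasing-cong (_ ∷ _ ∷ _)   (_ ∷ [])      ()

labelsIncreasing-tail : ∀ b bs → T (labelsIncreasing (b ∷ bs)) → T (labelsIncreasing bs)
labelsIncreasing-tail b []       _ = _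
labelsIncreasing-tail b (c ∷ bs) t = proj₂ (∧-elim t)

labelsIncreasing-snoc⁺ : ∀ r c → T (labelsIncreasing r) → All (λ b → label b < label c) r →
                         T (labelsIncreasing (r ++ c ∷ []))
labelsIncreasing-snoc⁺ []            c _ _          = _
labelsIncreasing-snoc⁺ (b ∷ [])      c _ (b<c ∷ _)  = ∧-intro (<⇒<ᵇ b<c) _
labelsIncreasing-snoc⁺ (b ∷ b′ ∷ r) c t (_ ∷ r<c) =
  ∧-intro (proj₁ (∧-elim t)) (labelsIncreasing-snoc⁺ (b′ ∷ r) c (proj₂ (∧-elim t)) r<c)

labelsIncreasing-snoc⁻ : ∀ r c → T (labelsIncreasing (r ++ c ∷ [])) → T (labelsIncreasing r)
labelsIncreasing-snoc⁻ []            c _ = _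
labelsIncreasing-snoc⁻ (b ∷ [])      c _ = _
labelsIncreasing-snoc⁻ (b ∷ b′ ∷ r) c t =
  ∧-intro (proj₁ (∧-elim t)) (labelsIncreasing-snoc⁻ (b′ ∷ r) c (proj₂ (∧-elim t)))

-- Changed w Q i r bs: bs arises from r by replacing a single block b by b′ with
-- Q p b b′; the index i is p plus the weights w of all blocks in front of b.
data Changed (w : List ℕ → ℕ) (Q : ℕ → List ℕ → List ℕ → Set) : ℕ → Blocks → Blocks → Set where
  here  : ∀ {p b b′ r} → Q p b b′ → Changed w Q p (b ∷ r) (b′ ∷ r)
  there : ∀ {i b r bs} → Changed w Q i r bs → Changed w Q (w b + i) (b ∷ r) (b ∷ bs)

weight : (List ℕ → ℕ) → Blocks → ℕ
weight w r = sum (map w r)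

changeAt : (w : List ℕ → ℕ) → (ℕ → List ℕ → List ℕ) → ℕ → Blocks → Blocks
changeAt w f i []      = []
changeAt w f i (b ∷ r) with i <? w b
... | yes _ = f i b ∷ r
... | no  _ = b ∷ changeAt w f (i ∸ w b) r

module _ {w : List ℕ → ℕ} {Q : ℕ → List ℕ → List ℕ → Set} where

  changed-length : ∀ {i r bs} → Changed w Q i r bs → length bs ≡ length r
  changed-length (here _)  = refl
  changed-length (there c) = cong suc (changed-length c)

  changed-All⁺ : ∀ {P : List ℕ → Set} → (∀ {p b b′} → Q p b b′ → P b′) →
                 ∀ {i r bs} → Changed w Q i r bs → All P r → All P bs
  changed-All⁺ Q⇒P (here q)  (_ ∷ ps)  = Q⇒P q ∷ ps
  changed-All⁺ Q⇒P (there c) (pb ∷ ps) = pb ∷ changed-All⁺ Q⇒P c ps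

  changed-All⁻ : ∀ {P : List ℕ → Set} → (∀ {p b b′} → Q p b b′ → P b) →
                 ∀ {i r bs} → Changed w Q i r bs → All P bs → All P r
  changed-All⁻ Q⇒P (here q)  (_ ∷ ps)  = Q⇒P q ∷ ps
  changed-All⁻ Q⇒P (there c) (pb ∷ ps) = pb ∷ changed-All⁻ Q⇒P c ps

  changed-ins : ∀ {x} → (∀ {p b b′} → Q p b b′ → Ins x b b′) →
                ∀ {i r bs} → Changed w Q i r bs → Ins x (concat r) (concat bs)
  changed-ins Q⇒ins (here {r = r} q) = ins-++ʳ (concat r) (Q⇒ins q)
  changed-ins Q⇒ins (there {b = b} c) = ins-++ˡ b (changed-ins Q⇒ins c)

  changed-map : ∀ {P : List ℕ → Set} {A : Set} (f : List ℕ → A) →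
                (∀ {p b b′} → Q p b b′ → P b → f b′ ≡ f b) →
                ∀ {i r bs} → Changed w Q i r bs → All P r → map f bs ≡ map f r
  changed-map f Q⇒≡ (here {r = r} q) (pb ∷ _) = cong (_∷ map f r) (Q⇒≡ q pb)
  changed-map f Q⇒≡ (there {b = b} c) (_ ∷ ps) = cong (f b ∷_) (changed-map f Q⇒≡ c ps)

  changed-sum : ∀ {P : List ℕ → Set} (f : List ℕ → ℕ) d →
                (∀ {p b b′} → Q p b b′ → P b → f b′ ≡ d + f b) →
                ∀ {i r bs} → Changed w Q i r bs → All P r → sum (map f bs) ≡ d + sum (map f r)
  changed-sum f d Q⇒≡ (here {r = r} q) (pb ∷ _) =
    trans (cong (_+ sum (map f r)) (Q⇒≡ q pb)) (+-assoc d _ _)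
  changed-sum f d Q⇒≡ (there {b = b} c) (_ ∷ ps) =
    trans (cong (f b +_) (changed-sum f d Q⇒≡ c ps)) (+-exchange (f b) d _)

  changed-bound : (∀ {p b b′} → Q p b b′ → p < w b) → ∀ {i r bs} → Changed w Q i r bs → i < weight w r
  changed-bound Q⇒< (here q)          = <-≤-trans (Q⇒< q) (m≤m+n _ _)
  changed-bound Q⇒< (there {b = b} c) = +-monoʳ-< (w b) (changed-bound Q⇒< c)

  changeAt-changed : ∀ {P : List ℕ → Set} (f : ℕ → List ℕ → List ℕ) →
                     (∀ {p b} → P b → p < w b → Q p b (f p b)) →
                     ∀ i r → All P r → i < weight w r → Changed w Q i r (changeAt w f i r)
  changeAt-changed f mkQ i (b ∷ r) (pb ∷ ps) i<wr with i <? w b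
  ... | yes i<wb = here (mkQ pb i<wb)
  ... | no  i≮wb =
    subst (λ z → Changed w Q z (b ∷ r) (b ∷ changeAt w f (i ∸ w b) r)) (m+[n∸m]≡n (≮⇒≥ i≮wb))
          (there (changeAt-changed f mkQ (i ∸ w b) r ps rest<wr))
    where
    rest<wr : i ∸ w b < weight w r
    rest<wr = subst (i ∸ w b <_) (m+n∸m≡n (w b) (weight w r)) (∸-monoˡ-< i<wr (≮⇒≥ i≮wb))

  changed-changeAt : ∀ (f : ℕ → List ℕ → List ℕ) →
                     (∀ {p b b′} → Q p b b′ → b′ ≡ f p b × p < w b) →
                     ∀ {i r bs} → Changed w Q i r bs → bs ≡ changeAt w f i r
  changed-changeAt f Q⇒f (here {p} {b} {r = r} q) with p <? w b
  ... | yes _   = cong (_∷ r) (proj₁ (Q⇒f q))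
  ... | no  p≮w = ⊥-elim (p≮w (proj₂ (Q⇒f q)))
  changed-changeAt f Q⇒f (there {i} {b} c) with w b + i <? w b
  ... | yes wb+i<wb = ⊥-elim (m+n≮m (w b) i wb+i<wb)
  ... | no  _ rewrite m+n∸m≡n (w b) i = cong (b ∷_) (changed-changeAt f Q⇒f c)

weight-one : ∀ r → weight (λ _ → 1) r ≡ length r
weight-one []      = refl
weight-one (_ ∷ r) = cong suc (weight-one r)

weight-length : ∀ r → weight length r ≡ length (concat r)
weight-length []      = refl
weight-length (b ∷ r) = trans (cong (length b +_) (weight-length r)) (sym (length-++ b))

ins-concat : ∀ {x : ℕ} {r bs : Blocks} → Ins (x ∷ []) r bs → Ins x (concat r) (concat bs)
ins-concat here              = here
ins-concat (there {b} i) = ins-++ˡ b (ins-concat i)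

module Largest (n : ℕ) where

  N : ℕ
  N = suc n

  FreeOfN : Blocks → Set
  FreeOfN = All (All (_≢ N))

  N-occurs : ∀ {bs} → IsPermOfRange N (concat bs) → ¬ FreeOfN bs
  N-occurs {bs} (mkPerm len rng u) free =
    1+n≰n (subst (_≤ n) len (pigeonhole n (concat bs) u (InRange-lower rng (All.concat⁺ free))))

  entries<N : ∀ {r} → IsPermOfRange n (concat r) → All (All (_< N)) r
  entries<N p = All-map (All-map (λ (_ , q) → s≤s q)) (All.concat⁻ (inRange p))

  free-of-N : ∀ {r} → IsPermOfRange n (concat r) → FreeOfN r
  free-of-N p = All-map (All-map (λ x<N x≡N → <-irrefl x≡N x<N)) (entries<N p)

  record Insertion (w : List ℕ → ℕ) (Q : ℕ → List ℕ → List ℕ → Set) (d : ℕ) : Set where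
    field
      adds-N    : ∀ {p b b′} → Q p b b′ → Ins N b b′
      nonEmpty  : ∀ {p b b′} → Q p b b′ → NonEmpty b
      bounded   : ∀ {p b b′} → Q p b b′ → p < w b
      nse-shift : ∀ {p b b′} → Q p b b′ → All (_< N) b → nseBlock b′ ≡ d + nseBlock b
  open Insertion public

  module _ {w Q d} (K : Insertion w Q d) where

    changed-labels : ∀ {i r bs} → Changed w Q i r bs → All (All (_< N)) r → map label bs ≡ map label r
    changed-labels = changed-map label (λ q b<N → label-ins (adds-N K q) (nonEmpty K q) (All-map <⇒≤ b<N))

    changed-IsSLP⁻ : ∀ {i k j r bs} → Changed w Q i r bs → IsSLP N k j bs →
                     IsSLP n k (nse r) r × j ≡ d + nse r
    changed-IsSLP⁻ {r = r} {bs} c s =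
      mkSLP (trans (sym (changed-length c)) (blockCount s))
            (changed-All⁻ (nonEmpty K) c (blocksNonEmpty s)) perm-r
            (subst T (labelsIncreasing-cong bs r (changed-labels c r<N)) (increasing s)) refl
      , trans (sym (nse≡ s)) (changed-sum nseBlock d (nse-shift K) c r<N)
      where
      perm-r = perm-ins⁻ (perm s) (changed-ins (adds-N K) c)
      r<N    = entries<N perm-r

    changed-IsSLP⁺ : ∀ {i k j r bs} → Changed w Q i r bs → IsSLP n k j r → IsSLP N k (d + j) bs
    changed-IsSLP⁺ {r = r} {bs} c s =
      mkSLP (trans (changed-length c) (blockCount s))
            (changed-All⁺ (ins-NonEmpty ∘ adds-N K) c (blocksNonEmpty s))
            (perm-ins⁺ (perm s) (changed-ins (adds-N K) c))
            (subst T (sym (labelsIncreasing-cong bs r (changed-labels c r<N))) (increasing s))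
            (trans (changed-sum nseBlock d (nse-shift K) c r<N) (cong (d +_) (nse≡ s)))
      where r<N = entries<N (perm s)

  data Appended : ℕ → List ℕ → List ℕ → Set where
    appended : ∀ {ys} → NonEmpty ys → Appended 0 ys (ys ++ N ∷ [])

  appending : Insertion (λ _ → 1) Appended 0
  appending .adds-N    (appended {ys} _)  = ins-snoc ys
  appending .nonEmpty  (appended ne)      = ne
  appending .bounded   (appended _)       = s≤s z≤n
  appending .nse-shift (appended {ys} _) ys<N = nseBlock-snoc N ys (All-map <⇒≤ ys<N)

  data Inside : ℕ → List ℕ → List ℕ → Set where
    inside : ∀ {p ys} → p < length ys → Inside p ys (insAt N p ys)

  insideBlock : Insertion length Inside 1
  insideBlock .adds-N    (inside {p} {ys} _) = insAt-ins N p ys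
  insideBlock .nonEmpty  (inside {ys = _ ∷ _} _) = _
  insideBlock .bounded   (inside p<len)      = p<len
  insideBlock .nse-shift (inside {p} {ys} p<len) ys<N = nseBlock-insAt N p ys p<len ys<N

  -- N appended to the i-th block, resp. inserted before the i-th entry of concat r.
  AppendedTo : ℕ → Blocks → Blocks → Set
  AppendedTo = Changed (λ _ → 1) Appended

  InsertedBefore : ℕ → Blocks → Blocks → Set
  InsertedBefore = Changed length Inside

  singleton-last : ∀ {r bs} → Ins (N ∷ []) r bs → T (labelsIncreasing bs) → All (All (_≤ N)) bs →
                   bs ≡ r ++ (N ∷ []) ∷ []
  singleton-last (here {[]})     _ _                = refl
  singleton-last (here {c ∷ cs}) t (_ ∷ c≤N ∷ _) =
    ⊥-elim (<⇒≱ (<ᵇ⇒< N (label c) (proj₁ (∧-elim t))) (label-≤ c c≤N))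
  singleton-last (there {b} {r} {bs} i) t (_ ∷ bs≤N) =
    cong (b ∷_) (singleton-last i (labelsIncreasing-tail b bs t) bs≤N)

  singleton-IsSLP⁻ : ∀ {k j r bs} → Ins (N ∷ []) r bs → IsSLP N (suc k) j bs → IsSLP n k j r
  singleton-IsSLP⁻ {r = r} {bs} i s =
    mkSLP (suc-injective (trans (sym (ins-length i)) (blockCount s)))
          (proj₂ (All-ins⁻ i (blocksNonEmpty s)))
          (perm-ins⁻ (perm s) (ins-concat i))
          (labelsIncreasing-snoc⁻ r (N ∷ []) (subst (T ∘ labelsIncreasing) bs≡ (increasing s)))
          (trans (sym (sum-map-ins nseBlock i)) (nse≡ s))
    where
    bs≡ = singleton-last i (increasing s) (All-map (All-map proj₂) (All.concat⁻ (inRange (perm s))))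

  singleton-IsSLP⁺ : ∀ {k j r} → IsSLP n k j r → IsSLP N (suc k) j (r ++ (N ∷ []) ∷ [])
  singleton-IsSLP⁺ {r = r} s =
    mkSLP (trans (ins-length i) (cong suc (blockCount s)))
          (All-ins⁺ i _ (blocksNonEmpty s))
          (perm-ins⁺ (perm s) (ins-concat i))
          (labelsIncreasing-snoc⁺ r (N ∷ []) (increasing s)
             (All-map (λ b<N → s≤s (label-≤ _ (All-map s≤s⁻¹ b<N))) (entries<N (perm s))))
          (trans (sum-map-ins nseBlock i) (nse≡ s))
    where i = ins-snoc r

  data BlockCode : Set where
    absent alone : BlockCode
    last         : List ℕ → BlockCode
    before       : List ℕ → ℕ → BlockCode

  startsWithN : List ℕ → BlockCode
  startsWithN []       = alone
  startsWithN (y ∷ ys) = before (y ∷ ys) 0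

  consCode : ℕ → BlockCode → BlockCode
  consCode x absent        = absent
  consCode x alone         = last (x ∷ [])
  consCode x (last ys)     = last (x ∷ ys)
  consCode x (before ys p) = before (x ∷ ys) (suc p)

  blockCode : List ℕ → BlockCode
  blockCode []       = absent
  blockCode (x ∷ xs) with x ≟ N
  ... | yes _ = startsWithN xs
  ... | no  _ = consCode x (blockCode xs)

  data BlockView : List ℕ → BlockCode → Set where
    absent : ∀ {b} → All (_≢ N) b → BlockView b absent
    alone  : BlockView (N ∷ []) alone
    last   : ∀ {ys b} → Appended 0 ys b → BlockView b (last ys)
    before : ∀ {p ys b} → Inside p ys b → BlockView b (before ys p)

  blockView : ∀ b → BlockView b (blockCode b)
  blockView []       = absent []
  blockView (x ∷ xs) with x ≟ N
  ... | yes refl = startsWith xs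
    where
    startsWith : ∀ xs → BlockView (N ∷ xs) (startsWithN xs)
    startsWith []       = alone
    startsWith (y ∷ ys) = before (inside {0} {y ∷ ys} (s≤s z≤n))
  ... | no  x≢N  = cons (blockCode xs) (blockView xs)
    where
    cons : ∀ c {xs} → BlockView xs c → BlockView (x ∷ xs) (consCode x c)
    cons _ (absent free)                    = absent (x≢N ∷ free)
    cons _ alone                            = last (appended {x ∷ []} _)
    cons _ (last (appended {ys} _))         = last (appended {x ∷ ys} _)
    cons _ (before (inside {p} {ys} p<len)) = before (inside {suc p} {x ∷ ys} (s≤s p<len))

  blockCode-N : ∀ xs → blockCode (N ∷ xs) ≡ startsWithN xs
  blockCode-N xs with N ≟ N
  ... | yes _   = refl
  ... | no  N≢N = ⊥-elim (N≢N refl)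

  blockCode-cons : ∀ x xs → x ≢ N → blockCode (x ∷ xs) ≡ consCode x (blockCode xs)
  blockCode-cons x xs x≢N with x ≟ N
  ... | yes x≡N = ⊥-elim (x≢N x≡N)
  ... | no  _   = refl

  blockCode-absent : ∀ b → All (_≢ N) b → blockCode b ≡ absent
  blockCode-absent []       _            = refl
  blockCode-absent (x ∷ xs) (x≢N ∷ free)
    rewrite blockCode-cons x xs x≢N | blockCode-absent xs free = refl

  blockCode-last : ∀ x ys → All (_≢ N) (x ∷ ys) → blockCode ((x ∷ ys) ++ N ∷ []) ≡ last (x ∷ ys)
  blockCode-last x []       (x≢N ∷ _) rewrite blockCode-cons x (N ∷ []) x≢N | blockCode-N [] = refl
  blockCode-last x (y ∷ ys) (x≢N ∷ free)
    rewrite blockCode-cons x ((y ∷ ys) ++ N ∷ []) x≢N | blockCode-last y ys free = refl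

  blockCode-before : ∀ p ys → p < length ys → All (_≢ N) ys → blockCode (insAt N p ys) ≡ before ys p
  blockCode-before zero    (y ∷ ys) _     _            = blockCode-N (y ∷ ys)
  blockCode-before (suc p) (y ∷ ys) p<len (y≢N ∷ free)
    rewrite blockCode-cons y (insAt N p ys) y≢N | blockCode-before p ys (s≤s⁻¹ p<len) free = refl

  -- Locating N in a whole listing: the listing r without N, and the index i
  -- of the block N was appended to, resp. of the entry of concat r it preceded.
  data Code : Set where
    noN            : Code
    newBlock       : Blocks → Code
    appendedTo     : Blocks → ℕ → Code
    insertedBefore : Blocks → ℕ → Code

  shift : List ℕ → Code → Code
  shift b noN                  = noN
  shift b (newBlock r)         = newBlock (b ∷ r)
  shift b (appendedTo r i)     = appendedTo (b ∷ r) (suc i)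
  shift b (insertedBefore r i) = insertedBefore (b ∷ r) (length b + i)

  decompose : Blocks → Code
  decomposeAt : List ℕ → BlockCode → Blocks → Code
  decompose []       = noN
  decompose (b ∷ bs) = decomposeAt b (blockCode b) bs
  decomposeAt b absent        bs = shift b (decompose bs)
  decomposeAt b alone         bs = newBlock bs
  decomposeAt b (last ys)     bs = appendedTo (ys ∷ bs) 0
  decomposeAt b (before ys p) bs = insertedBefore (ys ∷ bs) p

  data View (bs : Blocks) : Code → Set where
    noN            : FreeOfN bs → View bs noN
    newBlock       : ∀ {r} → Ins (N ∷ []) r bs → View bs (newBlock r)
    appendedTo     : ∀ {r i} → AppendedTo i r bs → View bs (appendedTo r i)
    insertedBefore : ∀ {r i} → InsertedBefore i r bs → View bs (insertedBefore r i)

  view : ∀ bs → View bs (decompose bs)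
  viewAt : ∀ b c → BlockView b c → ∀ bs → View (b ∷ bs) (decomposeAt b c bs)
  view []       = noN []
  view (b ∷ bs) = viewAt b (blockCode b) (blockView b) bs
  viewAt b _ (absent free) bs with decompose bs | view bs
  ... | _ | noN rest            = noN (free ∷ rest)
  ... | _ | newBlock i          = newBlock (there i)
  ... | _ | appendedTo c        = appendedTo (there c)
  ... | _ | insertedBefore c    = insertedBefore (there c)
  viewAt _ _ alone      bs = newBlock here
  viewAt _ _ (last a)   bs = appendedTo (here a)
  viewAt _ _ (before a) bs = insertedBefore (here a)

  decompose-newBlock : ∀ {r bs} → Ins (N ∷ []) r bs → FreeOfN r → decompose bs ≡ newBlock r
  decompose-newBlock here                   _            rewrite blockCode-N [] = refl
  decompose-newBlock (there {b} i) (free ∷ rest)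
    rewrite blockCode-absent b free | decompose-newBlock i rest = refl

  decompose-changed : ∀ {w Q} (C : Blocks → ℕ → Code) →
    (∀ {p b b′} bs → Q p b b′ → All (_≢ N) b → decompose (b′ ∷ bs) ≡ C (b ∷ bs) p) →
    (∀ b r i → shift b (C r i) ≡ C (b ∷ r) (w b + i)) →
    ∀ {i r bs} → Changed w Q i r bs → FreeOfN r → decompose bs ≡ C r i
  decompose-changed C at-head shift≡ (here {r = r} q) (free ∷ _) = at-head r q free
  decompose-changed C at-head shift≡ (there {i} {b} {r} c) (free ∷ rest)
    rewrite blockCode-absent b free | decompose-changed C at-head shift≡ c rest = shift≡ b r i

  decompose-appendedTo : ∀ {i r bs} → AppendedTo i r bs → FreeOfN r → decompose bs ≡ appendedTo r i
  decompose-appendedTo = decompose-changed appendedTo at-head (λ _ _ _ → refl)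
    where
    at-head : ∀ {p b b′} bs → Appended p b b′ → All (_≢ N) b →
              decompose (b′ ∷ bs) ≡ appendedTo (b ∷ bs) p
    at-head bs (appended {x ∷ ys} _) free rewrite blockCode-last x ys free = refl

  decompose-insertedBefore : ∀ {i r bs} → InsertedBefore i r bs → FreeOfN r → decompose bs ≡ insertedBefore r i
  decompose-insertedBefore = decompose-changed insertedBefore at-head (λ _ _ _ → refl)
    where
    at-head : ∀ {p b b′} bs → Inside p b b′ → All (_≢ N) b →
              decompose (b′ ∷ bs) ≡ insertedBefore (b ∷ bs) p
    at-head bs (inside {p} {ys} p<len) free rewrite blockCode-before p ys p<len free = refl

-- For j ≥ 1, a listing of SLP(n, k) with nse = j - 1 and a marked entry:
-- N is to be inserted right before the marked entry.
record Before (n k j : ℕ) : Set where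
  constructor mark
  field
    j′      : ℕ
    j≡1+j′  : j ≡ suc j′
    listing : SLPwith n k j′
    marked  : Fin n
open Before

Before-≡ : ∀ {n k j} {x y : Before n k j} →
           proj₁ (listing x) ≡ proj₁ (listing y) → marked x ≡ marked y → x ≡ y
Before-≡ {x = mark _ refl (r , _) i} {y = mark _ refl (.r , _) .i} refl refl = cong (λ l → mark _ refl l i) (Σ-T-≡ refl)

-- The three ways N = n + 1 can sit in a listing of SLP(n + 1, k + 1) with nse = j.
Pieces : ℕ → ℕ → ℕ → Set
Pieces n k j = SLPwith n k j ⊎ ((SLPwith n (suc k) j × Fin (suc k)) ⊎ Before n (suc k) j)

module Removal (n k : ℕ) where
  open Largest n

  appendAt insertAt : ℕ → Blocks → Blocks
  appendAt = changeAt (λ _ → 1) (λ _ b → b ++ N ∷ [])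
  insertAt = changeAt length (insAt N)

  appendAt-appendedTo : ∀ {k j r} → IsSLP n k j r → (i : Fin k) → AppendedTo (toℕ i) r (appendAt (toℕ i) r)
  appendAt-appendedTo {r = r} s i =
    changeAt-changed (λ _ b → b ++ N ∷ [])
      (λ ne i<1 → subst (λ p → Appended p _ _) (sym (n<1⇒n≡0 i<1)) (appended ne))
      (toℕ i) r (blocksNonEmpty s) (subst (toℕ i <_) (sym (trans (weight-one r) (blockCount s))) (toℕ<n i))

  insertAt-insertedBefore : ∀ {k j r} → IsSLP n k j r → (i : Fin n) →
                            InsertedBefore (toℕ i) r (insertAt (toℕ i) r)
  insertAt-insertedBefore {r = r} s i =
    changeAt-changed (insAt N) (λ _ p<len → inside p<len)
      (toℕ i) r (blocksNonEmpty s) (subst (toℕ i <_) (sym (trans (weight-length r) (length≡ (perm s)))) (toℕ<n i))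

  insertN : ∀ {j} → Pieces n k j → SLPwith N (suc k) j
  insertN (inj₁ (r , t)) =
    r ++ (N ∷ []) ∷ [] , IsSLP⇒SLPwith (singleton-IsSLP⁺ (SLPwith⇒IsSLP r t))
  insertN (inj₂ (inj₁ ((r , t) , i))) =
    appendAt (toℕ i) r , IsSLP⇒SLPwith (changed-IsSLP⁺ appending (appendAt-appendedTo s i) s)
    where s = SLPwith⇒IsSLP r t
  insertN (inj₂ (inj₂ (mark j′ j≡1+j′ (r , t) i))) =
    insertAt (toℕ i) r ,
      IsSLP⇒SLPwith (subst (λ m → IsSLP N (suc k) m (insertAt (toℕ i) r)) (sym j≡1+j′)
                           (changed-IsSLP⁺ insideBlock (insertAt-insertedBefore s i) s))
    where s = SLPwith⇒IsSLP r t

  encode : ∀ {j bs} → IsSLP N (suc k) j bs → ∀ c → View bs c → Pieces n k j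
  encode s _ (noN free) = ⊥-elim (N-occurs (perm s) free)
  encode s _ (newBlock {r} i) = inj₁ (r , IsSLP⇒SLPwith (singleton-IsSLP⁻ i s))
  encode s _ (appendedTo {r} {i} c) =
    let s′ , j≡nse = changed-IsSLP⁻ appending c s in
    inj₂ (inj₁ ( (r , IsSLP⇒SLPwith (subst (λ m → IsSLP n (suc k) m r) (sym j≡nse) s′))
               , fromℕ< (subst (i <_) (trans (weight-one r) (blockCount s′)) (changed-bound (bounded appending) c))))
  encode s _ (insertedBefore {r} {i} c) =
    let s′ , j≡1+nse = changed-IsSLP⁻ insideBlock c s in
    inj₂ (inj₂ (mark (nse r) j≡1+nse (r , IsSLP⇒SLPwith s′)
                     (fromℕ< (subst (i <_) (trans (weight-length r) (length≡ (perm s′))) (changed-bound (bounded insideBlock) c)))))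

  removeN : ∀ {j} → SLPwith N (suc k) j → Pieces n k j
  removeN (bs , t) = encode (SLPwith⇒IsSLP bs t) (decompose bs) (view bs)

  insertN-encode : ∀ {j bs} (s : IsSLP N (suc k) j bs) c (v : View bs c) → proj₁ (insertN (encode s c v)) ≡ bs
  insertN-encode s _ (noN free) = ⊥-elim (N-occurs (perm s) free)
  insertN-encode {bs = bs} s _ (newBlock i) =
    sym (singleton-last i (increasing s) (All-map (All-map proj₂) (All.concat⁻ (inRange (perm s)))))
  insertN-encode s _ (appendedTo {r} c) =
    trans (cong (λ i → appendAt i r) (toℕ-fromℕ< _))
          (sym (changed-changeAt (λ _ b → b ++ N ∷ []) (λ { (appended _) → refl , s≤s z≤n }) c))
  insertN-encode s _ (insertedBefore {r} c) =
    trans (cong (λ i → insertAt i r) (toℕ-fromℕ< _))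
          (sym (changed-changeAt (insAt N) (λ { (inside p<len) → refl , p<len }) c))

  encode-newBlock : ∀ {j bs} (s : IsSLP N (suc k) j bs) (x : SLPwith n k j) c (v : View bs c) →
                    c ≡ newBlock (proj₁ x) → encode s c v ≡ inj₁ x
  encode-newBlock s x _ (newBlock _) refl = cong inj₁ (Σ-T-≡ refl)

  encode-appendedTo : ∀ {j bs} (s : IsSLP N (suc k) j bs) (x : SLPwith n (suc k) j) (i : Fin (suc k))
                      c (v : View bs c) →
                      c ≡ appendedTo (proj₁ x) (toℕ i) → encode s c v ≡ inj₂ (inj₁ (x , i))
  encode-appendedTo s x i _ (appendedTo _) refl = cong (inj₂ ∘ inj₁) (cong₂ _,_ (Σ-T-≡ refl) (fromℕ<-toℕ i _))

  encode-insertedBefore : ∀ {j bs} (s : IsSLP N (suc k) j bs) (x : Before n (suc k) j) c (v : View bs c) →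
                          c ≡ insertedBefore (proj₁ (listing x)) (toℕ (marked x)) →
                          encode s c v ≡ inj₂ (inj₂ x)
  encode-insertedBefore s x _ (insertedBefore _) refl = cong (inj₂ ∘ inj₂) (Before-≡ refl (fromℕ<-toℕ _ _))

  removeN-insertN : ∀ {j} (x : Pieces n k j) → removeN (insertN x) ≡ x
  removeN-insertN (inj₁ (r , t)) =
    encode-newBlock _ (r , t) _ (view (r ++ (N ∷ []) ∷ []))
      (decompose-newBlock (ins-snoc r) (free-of-N (perm (SLPwith⇒IsSLP r t))))
  removeN-insertN (inj₂ (inj₁ ((r , t) , i))) =
    encode-appendedTo _ (r , t) i _ (view (appendAt (toℕ i) r))
      (decompose-appendedTo (appendAt-appendedTo s i) (free-of-N (perm s)))
    where s = SLPwith⇒IsSLP r t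
  removeN-insertN (inj₂ (inj₂ x@(mark _ _ (r , t) i))) =
    encode-insertedBefore _ x _ (view (insertAt (toℕ i) r))
      (decompose-insertedBefore (insertAt-insertedBefore s i) (free-of-N (perm s)))
    where s = SLPwith⇒IsSLP r t

  insertN-removeN : ∀ {j} (x : SLPwith N (suc k) j) → insertN (removeN x) ≡ x
  insertN-removeN (bs , t) = Σ-T-≡ (insertN-encode (SLPwith⇒IsSLP bs t) (decompose bs) (view bs))

  removal : ∀ {j} → SLPwith N (suc k) j ↔ Pieces n k j
  removal = mk↔ₛ′ removeN insertN removeN-insertN insertN-removeN

-- The number of canonical listings of SLP_{n,k} with nse = j, defined by the
-- recurrence that removing the largest element produces.
slpCount : ℕ → ℕ → ℕ → ℕ
beforeCount : ℕ → ℕ → ℕ → ℕ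
slpCount zero    zero    zero    = 1
slpCount zero    zero    (suc j) = 0
slpCount zero    (suc k) j       = 0
slpCount (suc n) zero    j       = 0
slpCount (suc n) (suc k) j       = slpCount n k j + (slpCount n (suc k) j * suc k + beforeCount n (suc k) j)

-- Insertions of the new largest element right before one of the n old entries.
beforeCount n k zero    = 0
beforeCount n k (suc j) = slpCount n k j * n

closedForm : ℕ → ℕ → ℕ → ℕ
closedForm n k j = stirling1 n (n ∸ j) * stirling2 (n ∸ j) k

stirling1-vanishes : ∀ n m → n < m → stirling1 n m ≡ 0
stirling1-vanishes zero    (suc m) _ = refl
stirling1-vanishes (suc n) (suc m) n<m
  rewrite stirling1-vanishes n (suc m) (m<n⇒m<1+n (s≤s⁻¹ n<m))
        | stirling1-vanishes n m (s≤s⁻¹ n<m) | *-zeroʳ n = refl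

stirling1-diagonal : ∀ n → stirling1 n n ≡ 1
stirling1-diagonal zero = refl
stirling1-diagonal (suc n)
  rewrite stirling1-vanishes n (suc n) ≤-refl | stirling1-diagonal n | *-zeroʳ n = refl

-- For n ≥ 1 the closed form satisfies the recurrence defining slpCount.
-- For j = 0 this is the recurrence of stirling2 (the factor stirling1 n n is 1).
closedForm-recurrence-zero : ∀ n k →
  closedForm (suc (suc n)) (suc k) 0 ≡ closedForm (suc n) k 0 + (closedForm (suc n) (suc k) 0 * suc k + 0)
closedForm-recurrence-zero n k
  rewrite stirling1-diagonal (suc (suc n)) | stirling1-diagonal (suc n) =
    regroup k (stirling2 (suc n) (suc k)) (stirling2 (suc n) k)
  where
  regroup : ∀ k a b → 1 * (suc k * a + b) ≡ 1 * b + (1 * a * suc k + 0)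
  regroup = solve-∀

-- For j ≥ 1 write t = (n + 1) ∸ j; both Stirling recurrences are unfolded at t.
-- If t = 0 every term vanishes because stirling1 (suc n) 0 = 0.
closedForm-recurrence-suc : ∀ n k j →
  closedForm (suc (suc n)) (suc k) (suc j)
    ≡ closedForm (suc n) k (suc j) + (closedForm (suc n) (suc k) (suc j) * suc k + closedForm (suc n) (suc k) j * suc n)
closedForm-recurrence-suc n k j
  rewrite sym (pred[m∸n]≡m∸[1+n] (suc n) j) with suc n ∸ j
... | zero  = refl
... | suc t = expand n k (stirling1 (suc n) (suc t)) (stirling1 (suc n) t) (stirling2 t (suc k)) (stirling2 t k)
  where
  expand : ∀ n k a b c d → (suc n * a + b) * (suc k * c + d)
                       ≡ b * d + (b * c * suc k + a * (suc k * c + d) * suc n)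
  expand = solve-∀

slpCount≡closedForm : ∀ n k j → slpCount (suc n) k j ≡ closedForm (suc n) k j
slpCount≡closedForm n zero j with suc n ∸ j
... | zero  = refl
... | suc t = sym (*-zeroʳ (stirling1 (suc n) (suc t)))
slpCount≡closedForm zero (suc zero) zero = refl
slpCount≡closedForm zero (suc (suc k)) zero rewrite *-zeroʳ k = refl
slpCount≡closedForm zero (suc zero) (suc j) rewrite 0∸n≡0 j = refl
slpCount≡closedForm zero (suc (suc k)) (suc j) rewrite 0∸n≡0 j = refl
slpCount≡closedForm (suc n) (suc k) zero
  rewrite slpCount≡closedForm n k zero | slpCount≡closedForm n (suc k) zero =
    sym (closedForm-recurrence-zero n k)
slpCount≡closedForm (suc n) (suc k) (suc j)
  rewrite slpCount≡closedForm n k (suc j) | slpCount≡closedForm n (suc k) (suc j)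
        | slpCount≡closedForm n (suc k) j =
    sym (closedForm-recurrence-suc n k j)

empty↔Fin0 : ∀ {A : Set} → (A → ⊥) → A ↔ Fin 0
empty↔Fin0 ¬a = mk↔ₛ′ (⊥-elim ∘ ¬a) (λ ()) (λ ()) (⊥-elim ∘ ¬a)

Fin-sum₃ : ∀ {a b c d} → (Fin a ⊎ ((Fin b × Fin c) ⊎ Fin d)) ↔ Fin (a + (b * c + d))
Fin-sum₃ = ↔-sym (↔-trans +↔⊎ (↔-refl ⊎-↔ (↔-trans +↔⊎ (*↔× ⊎-↔ ↔-refl))))

IsSLP-zero : ∀ {k j bs} → IsSLP 0 k j bs → bs ≡ []
IsSLP-zero {bs = []}            _ = refl
IsSLP-zero {bs = [] ∷ _}        s with blocksNonEmpty s
... | () ∷ _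
IsSLP-zero {bs = (_ ∷ _) ∷ _}   s with length≡ (perm s)
... | ()

IsSLP-noBlocks : ∀ {n j bs} → IsSLP (suc n) 0 j bs → ⊥
IsSLP-noBlocks {bs = []}    s with length≡ (perm s)
... | ()
IsSLP-noBlocks {bs = _ ∷ _} s with blockCount s
... | ()

slp-card : ∀ n k j → SLPwith n k j ↔ Fin (slpCount n k j)
slp-card zero zero zero =
  mk↔ₛ′ (λ _ → zero) (λ _ → [] , _) (λ { zero → refl })
        (λ (bs , t) → Σ-T-≡ (sym (IsSLP-zero (SLPwith⇒IsSLP bs t))))
slp-card zero zero (suc j) = empty↔Fin0 λ (bs , t) → absurd bs (SLPwith⇒IsSLP bs t)
  where
  absurd : ∀ bs → IsSLP 0 0 (suc j) bs → ⊥
  absurd bs s with IsSLP-zero s | nse≡ s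
  ... | refl | ()
slp-card zero (suc k) j = empty↔Fin0 λ (bs , t) → absurd bs (SLPwith⇒IsSLP bs t)
  where
  absurd : ∀ bs → IsSLP 0 (suc k) j bs → ⊥
  absurd bs s with IsSLP-zero s | blockCount s
  ... | refl | ()
slp-card (suc n) zero j = empty↔Fin0 λ (bs , t) → IsSLP-noBlocks (SLPwith⇒IsSLP bs t)
slp-card (suc n) (suc k) j =
  ↔-trans (Removal.removal n k)
    (↔-trans (slp-card n k j ⊎-↔ ((slp-card n (suc k) j ×-↔ ↔-refl) ⊎-↔ before-card j)) Fin-sum₃)
  where
  before-card : ∀ j → Before n (suc k) j ↔ Fin (beforeCount n (suc k) j)
  before-card zero    = empty↔Fin0 λ { (mark _ () _ _) }
  before-card (suc j) = ↔-trans before↔ (↔-trans (slp-card n (suc k) j ×-↔ ↔-refl) (↔-sym *↔×))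
    where
    before↔ : Before n (suc k) (suc j) ↔ (SLPwith n (suc k) j × Fin n)
    before↔ = mk↔ₛ′ (λ { (mark _ refl x i) → x , i }) (λ (x , i) → mark j refl x i)
                    (λ _ → refl) (λ { (mark _ refl _ _) → refl })

Unique-++-disjoint : ∀ {A : Set} {x y : A} xs {ys} → Unique (xs ++ ys) → x ∈ xs → y ∈ ys → x ≢ y
Unique-++-disjoint (_ ∷ zs) (fresh ∷ _) (here refl) y∈ys = lookup fresh (Any.++⁺ʳ zs y∈ys)
Unique-++-disjoint (_ ∷ zs) (_ ∷ u)     (there x∈zs) y∈ys = Unique-++-disjoint zs u x∈zs y∈ys

Unique-++ʳ : ∀ {A : Set} (xs : List A) {ys} → Unique (xs ++ ys) → Unique ys
Unique-++ʳ []       u       = u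
Unique-++ʳ (_ ∷ xs) (_ ∷ u) = Unique-++ʳ xs u

nsb-cons≡0 : ∀ b bs → nsb (b ∷ bs) ≡ 0 → any (λ c → label c <ᵇ label b) bs ≡ false × nsb bs ≡ 0
nsb-cons≡0 b bs nsb≡0 with any (λ c → label c <ᵇ label b) bs
... | false = refl , nsb≡0

-- In a listing with distinct entries and nonempty blocks, nsb vanishes exactly
-- when the labels increase: distinct blocks have distinct labels.
nsb≡0⇒increasing : ∀ bs → Unique (concat bs) → All NonEmpty bs → nsb bs ≡ 0 → T (labelsIncreasing bs)
nsb≡0⇒increasing []           _ _ _ = _
nsb≡0⇒increasing (_ ∷ [])     _ _ _ = _
nsb≡0⇒increasing (b ∷ c ∷ cs) u (b≠[] ∷ ne@(c≠[] ∷ _)) nsb≡0 =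
  ∧-intro (<⇒<ᵇ b<c) (nsb≡0⇒increasing (c ∷ cs) (Unique-++ʳ b u) ne (proj₂ split))
  where
  split = nsb-cons≡0 b (c ∷ cs) nsb≡0
  c≮b : ¬ label c < label b
  c≮b with any≡false⇒All _ (c ∷ cs) (proj₁ split)
  ... | c≮ᵇb ∷ _ = ≡false⇒¬T c≮ᵇb ∘ <⇒<ᵇ
  b<c : label b < label c
  b<c = ≤∧≢⇒< (≮⇒≥ c≮b)
          (Unique-++-disjoint b u (label-∈ b b≠[]) (Any.++⁺ˡ (label-∈ c c≠[])))

increasing⇒above : ∀ b bs → T (labelsIncreasing (b ∷ bs)) → All (λ c → label b < label c) bs
increasing⇒above b []       _ = []
increasing⇒above b (c ∷ cs) t =
  b<c ∷ All-map (<-trans b<c) (increasing⇒above c cs (proj₂ (∧-elim t)))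
  where b<c = <ᵇ⇒< (label b) (label c) (proj₁ (∧-elim t))

increasing⇒nsb≡0 : ∀ bs → T (labelsIncreasing bs) → nsb bs ≡ 0
increasing⇒nsb≡0 []       _ = refl
increasing⇒nsb≡0 (b ∷ bs) t
  rewrite All⇒any≡false (λ c → label c <ᵇ label b)
            (All-map (λ b<c → ¬T⇒≡false (<⇒≯ b<c ∘ <ᵇ⇒< _ _)) (increasing⇒above b bs t))
        | increasing⇒nsb≡0 bs (labelsIncreasing-tail b bs t) = refl

llp-nsb0↔slp : ∀ n k j → LLPwith n k 0 j ↔ SLPwith n k j
llp-nsb0↔slp n k j = mk↔ₛ′ to from (λ _ → Σ-T-≡ refl) (λ _ → Σ-T-≡ refl)
  where
  to : LLPwith n k 0 j → SLPwith n k j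
  to (bs , t) =
    let llp , rest      = ∧-elim {isLLP n k bs} t
        nsb-ok , nse-ok = ∧-elim {nsb bs ≡ᵇ 0} rest
        _ , ne-perm     = ∧-elim {length bs ≡ᵇ k} llp
        ne , prm        = ∧-elim {all nonempty bs} ne-perm
        incr = nsb≡0⇒increasing bs (distinct (isPermOfRange⇒IsPermOfRange n _ prm))
                 (All.all⁺ _ bs ne) (≡ᵇ⇒≡ _ 0 nsb-ok)
    in bs , ∧-intro (∧-intro llp incr) nse-ok

  from : SLPwith n k j → LLPwith n k 0 j
  from (bs , t) =
    let slp , nse-ok = ∧-elim {isSLP n k bs} t
        llp , incr   = ∧-elim {isLLP n k bs} slp
    in bs , ∧-intro llp (∧-intro (≡⇒≡ᵇ _ 0 (increasing⇒nsb≡0 bs incr)) nse-ok)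

mainTheorem2 : (n k j : ℕ) → 1 ≤ k → k ≤ n →
    HasCard (LLPwith n k 0 j) (stirling1 n (n ∸ j) * stirling2 (n ∸ j) k)
    × HasCard (SLPwith n k j) (stirling1 n (n ∸ j) * stirling2 (n ∸ j) k)
mainTheorem2 zero    zero    j () _
mainTheorem2 zero    (suc k) j _  ()
mainTheorem2 (suc n) k       j _  _  =
  ↔⇒⤖ (↔-trans (llp-nsb0↔slp (suc n) k j) slp↔closed) , ↔⇒⤖ slp↔closed
  where
  slp↔closed : SLPwith (suc n) k j ↔ Fin (closedForm (suc n) k j)
  slp↔closed = subst (λ m → SLPwith (suc n) k j ↔ Fin m) (slpCount≡closedForm n k j) (slp-card (suc n) k j)
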